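{- Consider the following two-player game between a random player $\mathfrak{R}$ and a deterministic player $\mathfrak{D}$. Initially there is a pile of $n \geq 1$ elements. The players alternate turns, with $\mathfrak{R}$ moving first. On each turn of $\mathfrak{R}$, if the pile contains exactly $m$ elements, $\mathfrak{R}$ removes $k$ elements, where $k$ is drawn uniformly at random from $\{1, \ldots, m\}$, independently of all previous draws. On each turn of $\mathfrak{D}$, $\mathfrak{D}$ removes exactly one element. The player who removes the last element (leaving the pile empty at the end of its turn) wins. Let $D_n$ denote the probability that $\mathfrak{D}$ wins when the game starts with $n$ elements. Then for every $n \geq 1$, $$D_n = \sum_{k=0}^{n} \frac{(-1)^k}{k!} = \frac{d_n}{n!},$$ where $d_n$ is the number of permutations of $\{1,\ldots,n\}$ with no fixed points (the $n$-th derangement number). In particular, $\lim_{n\to\infty} D_n = e^{ -1}$. -}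

module Defs where

open import Data.Nat using (ℕ; zero; suc; _!)
open import Data.Nat.Properties using (_!≢0)
open import Data.Fin using (Fin; zero; suc; inject₁)
open import Data.Fin.Properties using (all?; any?; _≟_)
open import Data.List using (List; []; _∷_; map; concatMap; length; filter; foldr; allFin)
open import Data.Vec using (Vec; []; _∷_; lookup; _∷ʳ_; last)
open import Data.Product using (_×_; ∃)
open import Data.Integer using (+_)
open import Data.Rational using (ℚ; _/_; _+_; _*_; -_; 0ℚ; 1ℚ)
open import Relation.Binary.PropositionalEquality using (_≡_; _≢_)
open import Relation.Nullary using (¬_; Dec)
open import Relation.Nullary.Decidable using (_×-dec_; ¬?)

sumℚ : List ℚ → ℚ
sumℚ = foldr _+_ 0ℚ

-- rVals m = (r₀, r₁, …, r_m) where r_j is the probability that the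
-- deterministic player 𝔇 wins when the random player ℜ is about to move
-- with a pile of j elements.  r₀ = 1 by convention: ℜ facing an empty
-- pile means 𝔇 just removed the last element and has won.
--
-- When 𝔇 is about to move with a pile of j elements:
--   j = 0      : ℜ removed the last element, 𝔇 lost (value 0);
--   j = suc i  : 𝔇 removes one element, ℜ then moves with pile i
--                (value r_i).

dVal : ∀ {m} → Vec ℚ (suc m) → Fin (suc m) → ℚ
dVal v zero    = 0ℚ
dVal v (suc i) = lookup v (inject₁ i)

-- ℜ moves with a pile of (suc m) elements, removing k ∈ {1,…,suc m}
-- uniformly at random; the remaining pile r = suc m - k ranges uniformly
-- over {0,…,m}, each with probability 1/(suc m), and then 𝔇 moves.
rStep : ∀ {m} → Vec ℚ (suc m) → ℚ
rStep {m} v = ((+ 1) / suc m) * sumℚ (map (dVal v) (allFin (suc m)))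

rVals : (m : ℕ) → Vec ℚ (suc m)
rVals zero    = 1ℚ ∷ []
rVals (suc m) = rVals m ∷ʳ rStep (rVals m)

D : ℕ → ℚ
D n = last (rVals n)

negOnePow : ℕ → ℚ
negOnePow zero    = 1ℚ
negOnePow (suc k) = - negOnePow k

invFact : ℕ → ℚ
invFact k = ((+ 1) / (k !)) {{k !≢0}}

altExpSum : ℕ → ℚ
altExpSum zero    = negOnePow zero * invFact zero
altExpSum (suc n) = altExpSum n + negOnePow (suc n) * invFact (suc n)

-- A permutation of {1,…,n} is represented in one-line notation as a
-- vector v : Vec (Fin n) n (i ↦ lookup v i) that is bijective.  A
-- derangement is such a permutation with no fixed point.

IsPermutation : ∀ {n} → Vec (Fin n) n → Set
IsPermutation {n} v =
  (∀ i → ∀ j → lookup v i ≡ lookup v j → i ≡ j) × (∀ j → ∃ λ i → lookup v i ≡ j)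

IsDerangement : ∀ {n} → Vec (Fin n) n → Set
IsDerangement v = IsPermutation v × (∀ i → lookup v i ≢ i)

isDerangement? : ∀ {n} → (v : Vec (Fin n) n) → Dec (IsDerangement v)
isDerangement? v =
  ((all? λ i → all? λ j → dimp (lookup v i ≟ lookup v j) (i ≟ j))
    ×-dec (all? λ j → any? λ i → lookup v i ≟ j))
  ×-dec (all? λ i → ¬? (lookup v i ≟ i))
  where
  open import Relation.Nullary.Decidable using (yes; no)
  dimp : ∀ {a b} {A : Set a} {B : Set b} → Dec A → Dec B → Dec (A → B)
  dimp _       (yes b) = yes (λ _ → b)
  dimp (yes a) (no ¬b) = no (λ f → ¬b (f a))
  dimp (no ¬a) (no _)  = yes (λ a → Data.Empty.⊥-elim (¬a a))
    where import Data.Empty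

allVecs : (m n : ℕ) → List (Vec (Fin n) m)
allVecs zero    n = [] ∷ []
allVecs (suc m) n = concatMap (λ i → map (i ∷_) (allVecs m n)) (allFin n)

derangements : ℕ → ℕ
derangements n = length (filter isDerangement? (allVecs n n))

-- Let r m be the probability that 𝔇 wins when ℜ is to move with m elements. ℜ leaves
-- j ∈ {0, …, m} elements with probability 1/(m + 1), and from j + 1 elements 𝔇 moves to j,
-- so (m + 1) r (m + 1) = r 0 + ⋯ + r (m − 1). The partial sums a m of Σ (−1)ᵏ/k! satisfy
-- the same recurrence with a 0 = 1 = r 0, because (m + 2) t (m + 2) = − t (m + 1) for the
-- terms t k = (−1)ᵏ/k!, which makes the sum telescope.
--
-- Let G n k count the permutations of n points without fixed points among
-- the first k. Deleting the entry at a position p with value q and renumbering is a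
-- bijection onto the permutations of n − 1 points; with p = 0 it gives
-- G (n + 1) 0 = (n + 1) G n 0, and with p = q = k it splits off the permutations fixing k,
-- giving G (n + 1) k = G (n + 1) (k + 1) + G n k. Eliminating the off-diagonal values yields
-- d (n + 2) = (n + 1) (d (n + 1) + d n), which n! a n satisfies as well; hence d n / n! = a n.

module Submission where

open import Defs
open import Data.Nat using (ℕ; _≤_; _!)
open import Data.Nat.Properties using (_!≢0)
open import Data.Integer using (+_)
open import Data.Rational using (_/_)
open import Data.Product using (_×_; _,_)
open import Relation.Binary.PropositionalEquality using (_≡_)

module Derangements where

  open import Function using (_∘_; id; case_of_)
  open import Function.Bundles using (mk⇔)
  open import Data.Empty using (⊥-elim)
  open import Data.Nat using (ℕ; zero; suc; _+_; _*_; _<_; _≤_; s≤s; s≤s⁻¹; z≤n)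
  open import Data.Nat.Tactic.RingSolver using (solve-∀)
  import Data.Nat.Properties as ℕ
  open import Data.Fin using (Fin; zero; suc; toℕ; punchIn; punchOut; fromℕ<)
  import Data.Fin.Properties as Fin
  open import Data.Fin.Properties
    using (_≟_; all?; any?; punchIn-punchOut; punchOut-punchIn; punchInᵢ≢i; punchIn-injective; punchOut-cong)
  open import Data.Vec using (Vec; []; _∷_; lookup; tabulate)
  import Data.Vec.Properties as Vec
  open import Data.List as List using (List; []; _∷_; map; filter; length; allFin)
  import Data.List.Properties as List
  open import Data.List.Membership.Propositional using (_∈_)
  import Data.List.Membership.Propositional.Properties as ∈
  open import Data.List.Membership.Propositional.Properties.WithK using (unique∧set⇒bag)
  open import Data.List.Relation.Binary.BagAndSetEquality using (∼bag⇒↭)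
  open import Data.List.Relation.Binary.Permutation.Propositional.Properties using (↭-length)
  open import Data.List.Relation.Binary.Disjoint.Propositional using (Disjoint)
  open import Data.List.Relation.Unary.All as All using ([]; _∷_)
  open import Data.List.Relation.Unary.AllPairs as AllPairs using ([]; _∷_)
  import Data.List.Relation.Unary.AllPairs.Properties as AllPairs
  open import Data.List.Relation.Unary.Any using (here; there)
  open import Data.List.Relation.Unary.Unique.Propositional using (Unique)
  import Data.List.Relation.Unary.Unique.Propositional.Properties as Unique
  open import Data.Product using (_×_; _,_; proj₁; proj₂; ∃)
  open import Relation.Binary.PropositionalEquality
  open import Relation.Binary.Definitions using (DecidableEquality)
  open import Relation.Nullary using (yes; no)
  open import Relation.Nullary.Decidable using (_×-dec_; _→-dec_; ¬?)
  open import Relation.Unary using (Decidable; _≐_)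
  open import Relation.Unary.Properties using (_∩?_; ∁?)

  -- With F t k = G (k + t) k, i.e. t positions free of constraint, the two hypotheses
  -- eliminate the shift in t and yield F t (k + 2) = (t + k + 1) F t (k + 1) + (k + 1) F t k,
  -- which on the diagonal t = 0 is the derangement recurrence.
  module DiagonalRecurrence
    (G : ℕ → ℕ → ℕ)
    (G-suc-zero : ∀ n → G (suc n) 0 ≡ suc n * G n 0)
    (G-suc : ∀ n k → k ≤ n → G (suc n) k ≡ G (suc n) (suc k) + G n k)
    where

    private
      F : ℕ → ℕ → ℕ
      F t k = G (k + t) k

      F-suc : ∀ t k → F (suc t) k ≡ F t (suc k) + F t k
      F-suc t k = trans (cong (λ n → G n k) (ℕ.+-suc k t)) (G-suc (k + t) k (ℕ.m≤m+n k t))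

      F-one : ∀ t → F t 1 ≡ t * F t 0
      F-one t = ℕ.+-cancelʳ-≡ (F t 0) (F t 1) (t * F t 0) (begin
        F t 1 + F t 0      ≡⟨ F-suc t 0 ⟨
        F (suc t) 0        ≡⟨ G-suc-zero t ⟩
        suc t * F t 0      ≡⟨ ℕ.+-comm (F t 0) (t * F t 0) ⟩
        t * F t 0 + F t 0  ∎)
        where open ≡-Reasoning

      three-term : ∀ k t → F t (2 + k) ≡ suc (t + k) * F t (suc k) + suc k * F t k
      three-term zero t = ℕ.+-cancelʳ-≡ (F t 1) _ _ (begin
        F t 2 + F t 1                       ≡⟨ F-suc t 1 ⟨
        F (suc t) 1                         ≡⟨ F-one (suc t) ⟩
        suc t * F (suc t) 0                 ≡⟨ cong (suc t *_) (F-suc t 0) ⟩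
        suc t * (F t 1 + F t 0)             ≡⟨ cong (λ z → suc t * (z + F t 0)) (F-one t) ⟩
        suc t * (t * F t 0 + F t 0)         ≡⟨ expand t (F t 0) ⟩
        suc (t + 0) * (t * F t 0) + 1 * F t 0 + t * F t 0   ≡⟨ cong (λ z → suc (t + 0) * z + 1 * F t 0 + z) (F-one t) ⟨
        suc (t + 0) * F t 1 + 1 * F t 0 + F t 1             ∎)
        where
        open ≡-Reasoning
        expand : ∀ t b → suc t * (t * b + b) ≡ suc (t + 0) * (t * b) + 1 * b + t * b
        expand = solve-∀
      three-term (suc k) t = ℕ.+-cancelʳ-≡ (F t (2 + k)) _ _ (begin
        F t (3 + k) + F t (2 + k)                                 ≡⟨ F-suc t (2 + k) ⟨
        F (suc t) (2 + k)                                         ≡⟨ three-term k (suc t) ⟩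
        suc (suc t + k) * F (suc t) (suc k) + suc k * F (suc t) k
          ≡⟨ cong₂ (λ y z → suc (suc t + k) * y + suc k * z) (F-suc t (suc k)) (F-suc t k) ⟩
        suc (suc t + k) * (x₂ + x₁) + suc k * (x₁ + x₀)           ≡⟨ expand t k x₀ x₁ x₂ ⟩
        suc (t + suc k) * x₂ + suc (suc k) * x₁ + (suc (t + k) * x₁ + suc k * x₀)
          ≡⟨ cong (_+_ (suc (t + suc k) * x₂ + suc (suc k) * x₁)) (three-term k t) ⟨
        suc (t + suc k) * x₂ + suc (suc k) * x₁ + x₂              ∎)
        where
        open ≡-Reasoning
        x₀ = F t k
        x₁ = F t (suc k)
        x₂ = F t (2 + k)
        expand : ∀ t k x₀ x₁ x₂ → suc (suc t + k) * (x₂ + x₁) + suc k * (x₁ + x₀)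
          ≡ suc (t + suc k) * x₂ + suc (suc k) * x₁ + (suc (t + k) * x₁ + suc k * x₀)
        expand = solve-∀

    diagonal-recurrence : ∀ k → G (2 + k) (2 + k) ≡ suc k * (G (suc k) (suc k) + G k k)
    diagonal-recurrence k = begin
      G (2 + k) (2 + k)                           ≡⟨ F-diagonal (2 + k) ⟨
      F 0 (2 + k)                                 ≡⟨ three-term k 0 ⟩
      suc k * F 0 (suc k) + suc k * F 0 k
        ≡⟨ cong₂ (λ y z → suc k * y + suc k * z) (F-diagonal (suc k)) (F-diagonal k) ⟩
      suc k * G (suc k) (suc k) + suc k * G k k   ≡⟨ ℕ.*-distribˡ-+ (suc k) (G (suc k) (suc k)) (G k k) ⟨
      suc k * (G (suc k) (suc k) + G k k)         ∎
      where
      open ≡-Reasoning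
      F-diagonal : ∀ k → F 0 k ≡ G k k
      F-diagonal k = cong (λ n → G n k) (ℕ.+-identityʳ k)

  module _ {A : Set} {P Q : A → Set} (P? : Decidable P) (Q? : Decidable Q) where

    length-filter-split : ∀ xs → length (filter P? xs) ≡ length (filter (P? ∩? Q?) xs) + length (filter (P? ∩? ∁? Q?) xs)
    length-filter-split []       = refl
    length-filter-split (x ∷ xs) with P? x | Q? x
    ... | yes _ | yes _ = cong suc (length-filter-split xs)
    ... | yes _ | no  _ = trans (cong suc (length-filter-split xs)) (sym (ℕ.+-suc _ _))
    ... | no  _ | yes _ = length-filter-split xs
    ... | no  _ | no  _ = length-filter-split xs

    length-filter-≐ : ∀ xs → P ≐ Q → length (filter P? xs) ≡ length (filter Q? xs)
    length-filter-≐ xs P≐Q = cong length (List.filter-≐ P? Q? P≐Q xs)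

  length-filter-bijection :
    ∀ {A B : Set} {P : A → Set} {Q : B → Set} (P? : Decidable P) (Q? : Decidable Q)
    {xs : List A} {ys : List B} → Unique xs → Unique ys → (∀ a → a ∈ xs) → (∀ b → b ∈ ys) →
    (f : A → B) (g : B → A) → (∀ a → P a → Q (f a)) → (∀ b → Q b → P (g b)) →
    (∀ a → P a → g (f a) ≡ a) → (∀ b → Q b → f (g b) ≡ b) →
    length (filter P? xs) ≡ length (filter Q? ys)
  length-filter-bijection {A} {B} {P} {Q} P? Q? {xs} {ys} uxs uys xs-all ys-all f g fP gQ gf fg = begin
    length (filter P? xs)           ≡⟨ List.length-map f (filter P? xs) ⟨
    length (map f (filter P? xs))
      ≡⟨ ↭-length (∼bag⇒↭ (unique∧set⇒bag unique-image (Unique.filter⁺ Q? uys) (mk⇔ to from))) ⟩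
    length (filter Q? ys)           ∎
    where
    open ≡-Reasoning
    satisfies : ∀ {C : Set} {R : C → Set} (R? : Decidable R) zs {c} → c ∈ filter R? zs → R c
    satisfies R? zs c∈ = proj₂ (∈.∈-filter⁻ R? {xs = zs} c∈)
    g∘f-id : map g (map f (filter P? xs)) ≡ filter P? xs
    g∘f-id = trans (sym (List.map-∘ (filter P? xs)))
                   (List.map-id-local (All.tabulate λ a∈ → gf _ (satisfies P? xs a∈)))
    unique-image : Unique (map f (filter P? xs))
    unique-image = Unique.map⁻ (subst Unique (sym g∘f-id) (Unique.filter⁺ P? uxs))
    to : ∀ {b} → b ∈ map f (filter P? xs) → b ∈ filter Q? ys
    to b∈ with ∈.∈-map⁻ f b∈
    ... | a , a∈ , refl = ∈.∈-filter⁺ Q? (ys-all (f a)) (fP a (satisfies P? xs a∈))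
    from : ∀ {b} → b ∈ filter Q? ys → b ∈ map f (filter P? xs)
    from {b} b∈ = subst (_∈ map f (filter P? xs)) (fg b (satisfies Q? ys b∈))
                        (∈.∈-map⁺ f (∈.∈-filter⁺ P? (xs-all (g b)) (gQ b (satisfies Q? ys b∈))))

  length-filter-fibres :
    ∀ {A B : Set} {P : A → Set} (P? : Decidable P) (_≟ᴮ_ : DecidableEquality B) (h : A → B) (c : ℕ)
    (xs : List A) {ys : List B} → Unique ys → (∀ a → P a → h a ∈ ys) →
    (∀ y → y ∈ ys → length (filter (P? ∩? (λ a → h a ≟ᴮ y)) xs) ≡ c) →
    length (filter P? xs) ≡ length ys * c
  length-filter-fibres P? _≟ᴮ_ h c xs [] h∈ fibre =
    cong length (List.filter-none P? {xs} (All.tabulate λ {a} _ Pa → case h∈ a Pa of λ ()))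
  length-filter-fibres P? _≟ᴮ_ h c xs {y ∷ ys} (y∉ys ∷ unique) h∈ fibre = begin
    length (filter P? xs)                                                   ≡⟨ length-filter-split P? hy? xs ⟩
    length (filter (P? ∩? hy?) xs) + length (filter (P? ∩? ∁? hy?) xs)    ≡⟨ cong₂ _+_ (fibre y (here refl)) rest ⟩
    c + length ys * c                                                       ∎
    where
    open ≡-Reasoning
    hy? = λ a → h a ≟ᴮ y
    rest : length (filter (P? ∩? ∁? hy?) xs) ≡ length ys * c
    rest = length-filter-fibres (P? ∩? ∁? hy?) _≟ᴮ_ h c xs unique
      (λ a (Pa , ha≢y) → case h∈ a Pa of λ where
         (here ha≡y) → ⊥-elim (ha≢y ha≡y)
         (there ha∈) → ha∈)
      (λ y′ y′∈ → trans (length-filter-≐ _ _ xs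
                           ((λ ((Pa , _) , ha≡y′) → Pa , ha≡y′) ,
                            (λ (Pa , ha≡y′) → (Pa , λ ha≡y → All.lookup y∉ys y′∈ (trans (sym ha≡y) ha≡y′))
                                              , ha≡y′)))
                        (fibre y′ (there y′∈)))

  allVecs-complete : ∀ m n (v : Vec (Fin n) m) → v ∈ allVecs m n
  allVecs-complete zero    n []      = here refl
  allVecs-complete (suc m) n (x ∷ v) =
    ∈.∈-concat⁺′ (∈.∈-map⁺ (x ∷_) (allVecs-complete m n v))
                 (∈.∈-map⁺ (λ i → map (i ∷_) (allVecs m n)) (∈.∈-allFin x))

  allVecs-unique : ∀ m n → Unique (allVecs m n)
  allVecs-unique zero    n = [] ∷ []
  allVecs-unique (suc m) n =
    Unique.concat⁺ (All.tabulate unique-block) (AllPairs.map⁺ (AllPairs.map disjoint-blocks (Unique.allFin⁺ n)))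
    where
    block : Fin n → List (Vec (Fin n) (suc m))
    block i = map (i ∷_) (allVecs m n)
    unique-block : ∀ {vs} → vs ∈ map block (allFin n) → Unique vs
    unique-block vs∈ with ∈.∈-map⁻ block vs∈
    ... | i , _ , refl = Unique.map⁺ (λ eq → proj₂ (Vec.∷-injective eq)) (allVecs-unique m n)
    disjoint-blocks : ∀ {i j} → i ≢ j → Disjoint (block i) (block j)
    disjoint-blocks i≢j (v∈i , v∈j) with ∈.∈-map⁻ (_ ∷_) v∈i | ∈.∈-map⁻ (_ ∷_) v∈j
    ... | _ , _ , refl | _ , _ , eq = i≢j (proj₁ (Vec.∷-injective eq))

  data PunchInView {n} (p : Fin (suc n)) : Fin (suc n) → Set where
    hole    : PunchInView p p
    punched : ∀ j → PunchInView p (punchIn p j)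

  punchInView : ∀ {n} (p i : Fin (suc n)) → PunchInView p i
  punchInView p i with p ≟ i
  ... | yes refl = hole
  ... | no  p≢i  = subst (PunchInView p) (punchIn-punchOut p≢i) (punched (punchOut p≢i))

  punchIn-below : ∀ {n} (p : Fin (suc n)) j → toℕ j < toℕ p → toℕ (punchIn p j) ≡ toℕ j
  punchIn-below (suc p) zero    _        = refl
  punchIn-below (suc p) (suc j) (s≤s j<p) = cong suc (punchIn-below p j j<p)

  below-punchIn : ∀ {n} (p : Fin (suc n)) j → toℕ (punchIn p j) < toℕ p → toℕ j < toℕ p
  below-punchIn (suc p) zero    _         = s≤s z≤n
  below-punchIn (suc p) (suc j) (s≤s lt)  = s≤s (below-punchIn p j lt)

  -- Total version of punchOut; the value zero at the hole itself is junk.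
  punchOut₀ : ∀ {n} → Fin (suc (suc n)) → Fin (suc (suc n)) → Fin (suc n)
  punchOut₀ q x with q ≟ x
  ... | yes _   = zero
  ... | no  q≢x = punchOut q≢x

  punchIn-punchOut₀ : ∀ {n} {q x : Fin (suc (suc n))} → q ≢ x → punchIn q (punchOut₀ q x) ≡ x
  punchIn-punchOut₀ {q = q} {x} q≢x with q ≟ x
  ... | yes q≡x = ⊥-elim (q≢x q≡x)
  ... | no  q≢x = punchIn-punchOut q≢x

  punchOut₀-punchIn : ∀ {n} (q : Fin (suc (suc n))) x → punchOut₀ q (punchIn q x) ≡ x
  punchOut₀-punchIn q x = punchIn-injective q _ _ (punchIn-punchOut₀ (punchInᵢ≢i q x ∘ sym))

  module Surgery {n} (p q : Fin (suc (suc n))) where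

    remove : Vec (Fin (suc (suc n))) (suc (suc n)) → Vec (Fin (suc n)) (suc n)
    remove v = tabulate λ j → punchOut₀ q (lookup v (punchIn p j))

    lookup-remove : ∀ v j → lookup (remove v) j ≡ punchOut₀ q (lookup v (punchIn p j))
    lookup-remove v = Vec.lookup∘tabulate (λ j → punchOut₀ q (lookup v (punchIn p j)))

    insertEntry : Vec (Fin (suc n)) (suc n) → Fin (suc (suc n)) → Fin (suc (suc n))
    insertEntry w i with p ≟ i
    ... | yes _   = q
    ... | no  p≢i = punchIn q (lookup w (punchOut p≢i))

    insert : Vec (Fin (suc n)) (suc n) → Vec (Fin (suc (suc n))) (suc (suc n))
    insert w = tabulate (insertEntry w)

    insert-hole : ∀ w → lookup (insert w) p ≡ q
    insert-hole w = trans (Vec.lookup∘tabulate (insertEntry w) p) entry-hole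
      where
      entry-hole : insertEntry w p ≡ q
      entry-hole with p ≟ p
      ... | yes _   = refl
      ... | no  p≢p = ⊥-elim (p≢p refl)

    insert-punchIn : ∀ w j → lookup (insert w) (punchIn p j) ≡ punchIn q (lookup w j)
    insert-punchIn w j = trans (Vec.lookup∘tabulate (insertEntry w) (punchIn p j)) entry-punchIn
      where
      entry-punchIn : insertEntry w (punchIn p j) ≡ punchIn q (lookup w j)
      entry-punchIn with p ≟ punchIn p j
      ... | yes p≡pj = ⊥-elim (punchInᵢ≢i p j (sym p≡pj))
      ... | no  p≢pj = cong (punchIn q ∘ lookup w) (trans (punchOut-cong p refl) (punchOut-punchIn p))

    module _ {v : Vec (Fin (suc (suc n))) (suc (suc n))} (perm : IsPermutation v) (v-hole : lookup v p ≡ q) where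

      punchIn-remove : ∀ j → punchIn q (lookup (remove v) j) ≡ lookup v (punchIn p j)
      punchIn-remove j = trans (cong (punchIn q) (lookup-remove v j)) (punchIn-punchOut₀ q≢)
        where
        q≢ : q ≢ lookup v (punchIn p j)
        q≢ eq = punchInᵢ≢i p j (proj₁ perm _ _ (trans (sym eq) (sym v-hole)))

      remove-isPermutation : IsPermutation (remove v)
      remove-isPermutation = injective , surjective
        where
        injective : ∀ j j′ → lookup (remove v) j ≡ lookup (remove v) j′ → j ≡ j′
        injective j j′ eq = punchIn-injective p j j′ (proj₁ perm _ _
          (trans (sym (punchIn-remove j)) (trans (cong (punchIn q) eq) (punchIn-remove j′))))
        surjective : ∀ y → ∃ λ j → lookup (remove v) j ≡ y
        surjective y with proj₂ perm (punchIn q y)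
        ... | i , vi≡ with punchInView p i
        ...   | hole      = ⊥-elim (punchInᵢ≢i q y (trans (sym vi≡) v-hole))
        ...   | punched j = j , punchIn-injective q _ _ (trans (punchIn-remove j) vi≡)

      insert-remove : insert (remove v) ≡ v
      insert-remove = trans (Vec.tabulate-cong entry) (Vec.tabulate∘lookup v)
        where
        entry : ∀ i → insertEntry (remove v) i ≡ lookup v i
        entry i with punchInView p i
        ... | hole      = trans (sym (Vec.lookup∘tabulate (insertEntry (remove v)) p)) (trans (insert-hole (remove v)) (sym v-hole))
        ... | punched j = trans (sym (Vec.lookup∘tabulate (insertEntry (remove v)) (punchIn p j)))
                                (trans (insert-punchIn (remove v) j) (punchIn-remove j))

    remove-insert : ∀ w → remove (insert w) ≡ w
    remove-insert w = trans (Vec.tabulate-cong entry) (Vec.tabulate∘lookup w)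
      where
      entry : ∀ j → punchOut₀ q (lookup (insert w) (punchIn p j)) ≡ lookup w j
      entry j = trans (cong (punchOut₀ q) (insert-punchIn w j)) (punchOut₀-punchIn q (lookup w j))

    insert-isPermutation : ∀ {w} → IsPermutation w → IsPermutation (insert w)
    insert-isPermutation {w} perm = injective , surjective
      where
      injective : ∀ i i′ → lookup (insert w) i ≡ lookup (insert w) i′ → i ≡ i′
      injective i i′ eq with punchInView p i | punchInView p i′
      ... | hole      | hole       = refl
      ... | hole      | punched j′ = ⊥-elim (punchInᵢ≢i q _ (sym (trans (sym (insert-hole w)) (trans eq (insert-punchIn w j′)))))
      ... | punched j | hole       = ⊥-elim (punchInᵢ≢i q _ (trans (sym (insert-punchIn w j)) (trans eq (insert-hole w))))
      ... | punched j | punched j′ = cong (punchIn p) (proj₁ perm j j′ (punchIn-injective q _ _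
                                       (trans (sym (insert-punchIn w j)) (trans eq (insert-punchIn w j′)))))
      surjective : ∀ y → ∃ λ i → lookup (insert w) i ≡ y
      surjective y with punchInView q y
      ... | hole      = p , insert-hole w
      ... | punched x with proj₂ perm x
      ...   | j , wj≡x = punchIn p j , trans (insert-punchIn w j) (cong (punchIn q) wj≡x)

  FixedPointFreeBelow : ∀ {n} → ℕ → Vec (Fin n) n → Set
  FixedPointFreeBelow k v = ∀ i → toℕ i < k → lookup v i ≢ i

  fixedPointFreeBelow? : ∀ {n} k → Decidable (FixedPointFreeBelow {n} k)
  fixedPointFreeBelow? k v = all? λ i → (toℕ i ℕ.<? k) →-dec ¬? (lookup v i ≟ i)

  isPermutation? : ∀ {n} → Decidable (IsPermutation {n})
  isPermutation? v = (all? λ i → all? λ j → (lookup v i ≟ lookup v j) →-dec (i ≟ j))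
                     ×-dec (all? λ j → any? λ i → lookup v i ≟ j)

  partialDerangements : ℕ → ℕ → ℕ
  partialDerangements n k = length (filter (isPermutation? ∩? fixedPointFreeBelow? k) (allVecs n n))

  derangements≡partialDerangements : ∀ n → derangements n ≡ partialDerangements n n
  derangements≡partialDerangements n = length-filter-≐ isDerangement? (isPermutation? ∩? fixedPointFreeBelow? n) (allVecs n n)
    ((λ (perm , fpf) → perm , λ i _ → fpf i) , (λ (perm , fpf) → perm , λ i → fpf i (Fin.toℕ<n i)))

  length-filter-sending : ∀ {n} (p q : Fin (suc (suc n))) {X Y} (X? : Decidable X) (Y? : Decidable Y) →
    (let open Surgery p q) →
    (∀ {v} → IsPermutation v → lookup v p ≡ q → X v → Y (remove v)) →
    (∀ {w} → IsPermutation w → Y w → X (insert w)) →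
    length (filter ((isPermutation? ∩? X?) ∩? (λ v → lookup v p ≟ q)) (allVecs (suc (suc n)) (suc (suc n))))
      ≡ length (filter (isPermutation? ∩? Y?) (allVecs (suc n) (suc n)))
  length-filter-sending p q X? Y? X⇒Y Y⇒X =
    length-filter-bijection _ _ (allVecs-unique _ _) (allVecs-unique _ _) (allVecs-complete _ _) (allVecs-complete _ _)
      remove insert
      (λ v ((perm , x) , v-hole) → remove-isPermutation {v} perm v-hole , X⇒Y perm v-hole x)
      (λ w (perm , y) → (insert-isPermutation perm , Y⇒X perm y) , insert-hole w)
      (λ v ((perm , _) , v-hole) → insert-remove {v} perm v-hole)
      (λ w _ → remove-insert w)
    where open Surgery p q

  partialDerangements-suc-zero : ∀ n → partialDerangements (suc n) 0 ≡ suc n * partialDerangements n 0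
  partialDerangements-suc-zero zero    = refl
  partialDerangements-suc-zero (suc n) = trans
    (length-filter-fibres (isPermutation? ∩? fixedPointFreeBelow? 0) _≟_ (λ v → lookup v zero)
       (partialDerangements (suc n) 0) (allVecs (suc (suc n)) (suc (suc n))) (Unique.allFin⁺ _) (λ v _ → ∈.∈-allFin _)
       (λ y _ → length-filter-sending zero y (fixedPointFreeBelow? 0) (fixedPointFreeBelow? 0) (λ _ _ _ _ ()) (λ _ _ _ ())))
    (cong (_* partialDerangements (suc n) 0) (List.length-tabulate {n = suc (suc n)} id))

  module _ {n} (p : Fin (suc (suc n))) where
    open Surgery p p

    remove-fixedPointFreeBelow : ∀ {v} → IsPermutation v → lookup v p ≡ p →
      FixedPointFreeBelow (toℕ p) v → FixedPointFreeBelow (toℕ p) (remove v)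
    remove-fixedPointFreeBelow {v} perm v-hole fpf j j<p remove-fixed =
      fpf (punchIn p j) (subst (_< toℕ p) (sym (punchIn-below p j j<p)) j<p)
          (trans (sym (punchIn-remove {v} perm v-hole j)) (cong (punchIn p) remove-fixed))

    insert-fixedPointFreeBelow : ∀ {w} → FixedPointFreeBelow (toℕ p) w → FixedPointFreeBelow (toℕ p) (insert w)
    insert-fixedPointFreeBelow {w} fpf i i<p insert-fixed with punchInView p i
    ... | hole      = ℕ.<-irrefl refl i<p
    ... | punched j = fpf j (below-punchIn p j i<p)
                          (punchIn-injective p _ _ (trans (sym (insert-punchIn w j)) insert-fixed))

  fixedPointFreeBelow-suc : ∀ {n} (p : Fin n) {v} →
    (FixedPointFreeBelow (toℕ p) v × lookup v p ≢ p) → FixedPointFreeBelow (suc (toℕ p)) v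
  fixedPointFreeBelow-suc p {v} (fpf , vp≢p) i i≤p with toℕ i ℕ.<? toℕ p
  ... | yes i<p = fpf i i<p
  ... | no  i≮p = subst (λ i → lookup v i ≢ i) (sym i≡p) vp≢p
    where i≡p = Fin.toℕ-injective (ℕ.≤-antisym (s≤s⁻¹ i≤p) (ℕ.≮⇒≥ i≮p))

  partialDerangements-suc-toℕ : ∀ {n} (p : Fin (suc n)) →
    partialDerangements (suc n) (toℕ p) ≡ partialDerangements (suc n) (suc (toℕ p)) + partialDerangements n (toℕ p)
  partialDerangements-suc-toℕ {zero}  zero = refl
  partialDerangements-suc-toℕ {suc n} p    = begin
    partialDerangements (2 + n) k                                      ≡⟨ length-filter-split P? fixes? vs ⟩
    length (filter (P? ∩? fixes?) vs) + length (filter (P? ∩? ∁? fixes?) vs)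
      ≡⟨ cong₂ _+_ (length-filter-sending p p _ _ (λ {v} → remove-fixedPointFreeBelow p {v})
                                                    (λ {w} _ → insert-fixedPointFreeBelow p {w}))
                   (length-filter-≐ _ (isPermutation? ∩? fixedPointFreeBelow? (suc k)) vs
                     ((λ {v} ((perm , fpf) , vp≢p) → perm , fixedPointFreeBelow-suc p {v} (fpf , vp≢p)) ,
                      (λ (perm , fpf) → (perm , λ i i<p → fpf i (ℕ.m<n⇒m<1+n i<p)) , fpf p (ℕ.n<1+n k)))) ⟩
    partialDerangements (suc n) k + partialDerangements (2 + n) (suc k) ≡⟨ ℕ.+-comm (partialDerangements (suc n) k) _ ⟩
    partialDerangements (2 + n) (suc k) + partialDerangements (suc n) k ∎
    where
    open ≡-Reasoning
    k = toℕ p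
    vs = allVecs (2 + n) (2 + n)
    P? = isPermutation? ∩? fixedPointFreeBelow? k
    fixes? = λ (v : Vec (Fin (2 + n)) (2 + n)) → lookup v p ≟ p

  partialDerangements-suc : ∀ n k → k ≤ n →
    partialDerangements (suc n) k ≡ partialDerangements (suc n) (suc k) + partialDerangements n k
  partialDerangements-suc n k k≤n =
    subst (λ k → partialDerangements (suc n) k ≡ partialDerangements (suc n) (suc k) + partialDerangements n k)
          (Fin.toℕ-fromℕ< (s≤s k≤n)) (partialDerangements-suc-toℕ (fromℕ< (s≤s k≤n)))

  open DiagonalRecurrence partialDerangements partialDerangements-suc-zero partialDerangements-suc

  derangements-suc-suc : ∀ n → derangements (2 + n) ≡ suc n * (derangements (suc n) + derangements n)
  derangements-suc-suc n = begin
    derangements (2 + n)                                         ≡⟨ derangements≡partialDerangements (2 + n) ⟩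
    partialDerangements (2 + n) (2 + n)                          ≡⟨ diagonal-recurrence n ⟩
    suc n * (partialDerangements (suc n) (suc n) + partialDerangements n n)
      ≡⟨ cong₂ (λ y z → suc n * (y + z)) (derangements≡partialDerangements (suc n)) (derangements≡partialDerangements n) ⟨
    suc n * (derangements (suc n) + derangements n)              ∎
    where open ≡-Reasoning

module AlternatingSeries where

  open import Function using (_∘_)
  open import Data.Nat as ℕ using (ℕ; zero; suc; _!)
  import Data.Nat.Properties as ℕ
  open import Data.Integer as ℤ using (+_)
  import Data.Integer.Properties as ℤ
  open import Data.Fin as Fin using (Fin; zero; suc; toℕ; inject₁)
  import Data.Fin.Properties as Fin
  open import Data.List as List using ([]; _∷_; applyUpTo; allFin)
  import Data.List.Properties as List
  open import Data.Vec as Vec using (_∷_; _∷ʳ_; lookup)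
  import Data.Vec.Properties as Vec
  open import Data.Rational using (ℚ; _/_; toℚᵘ; _+_; _*_; -_; 0ℚ; 1ℚ)
  import Data.Rational.Properties as ℚ
  open import Data.Rational.Unnormalised as ℚᵘ using (mkℚᵘ; *≡*)
  import Data.Rational.Unnormalised.Properties as ℚᵘ
  open import Data.Rational.Solver using (module +-*-Solver)
  open import Relation.Binary.PropositionalEquality
  open +-*-Solver
  open Derangements using (derangements-suc-suc)

  fromℕ : ℕ → ℚ
  fromℕ n = + n / 1

  toℚᵘ-/ : ∀ i n .{{_ : ℕ.NonZero n}} → toℚᵘ (i / n) ℚᵘ.≃ mkℚᵘ i (ℕ.pred n)
  toℚᵘ-/ i (suc n) = ℚ.toℚᵘ-fromℚᵘ (mkℚᵘ i n)

  fromℕ-+ : ∀ m n → fromℕ (m ℕ.+ n) ≡ fromℕ m + fromℕ n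
  fromℕ-+ m n = ℚ.toℚᵘ-injective (begin
    toℚᵘ (fromℕ (m ℕ.+ n))                   ≈⟨ toℚᵘ-/ (+ (m ℕ.+ n)) 1 ⟩
    mkℚᵘ (+ (m ℕ.+ n)) 0                     ≈⟨ *≡* (cong (ℤ._* + 1) numerator) ⟩
    mkℚᵘ (+ m) 0 ℚᵘ.+ mkℚᵘ (+ n) 0           ≈⟨ ℚᵘ.+-cong (toℚᵘ-/ (+ m) 1) (toℚᵘ-/ (+ n) 1) ⟨
    toℚᵘ (fromℕ m) ℚᵘ.+ toℚᵘ (fromℕ n)       ≈⟨ ℚ.toℚᵘ-homo-+ (fromℕ m) (fromℕ n) ⟨
    toℚᵘ (fromℕ m + fromℕ n)                 ∎)
    where
    open ℚᵘ.≃-Reasoning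
    numerator : + (m ℕ.+ n) ≡ + m ℤ.* + 1 ℤ.+ + n ℤ.* + 1
    numerator = trans (ℤ.pos-+ m n) (sym (cong₂ ℤ._+_ (ℤ.*-identityʳ (+ m)) (ℤ.*-identityʳ (+ n))))

  fromℕ-* : ∀ m n → fromℕ (m ℕ.* n) ≡ fromℕ m * fromℕ n
  fromℕ-* m n = ℚ.toℚᵘ-injective (begin
    toℚᵘ (fromℕ (m ℕ.* n))                   ≈⟨ toℚᵘ-/ (+ (m ℕ.* n)) 1 ⟩
    mkℚᵘ (+ (m ℕ.* n)) 0                     ≈⟨ *≡* (cong (ℤ._* + 1) (ℤ.pos-* m n)) ⟩
    mkℚᵘ (+ m) 0 ℚᵘ.* mkℚᵘ (+ n) 0           ≈⟨ ℚᵘ.*-cong (toℚᵘ-/ (+ m) 1) (toℚᵘ-/ (+ n) 1) ⟨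
    toℚᵘ (fromℕ m) ℚᵘ.* toℚᵘ (fromℕ n)       ≈⟨ ℚ.toℚᵘ-homo-* (fromℕ m) (fromℕ n) ⟨
    toℚᵘ (fromℕ m * fromℕ n)                 ∎)
    where open ℚᵘ.≃-Reasoning

  fromℕ-suc : ∀ n → fromℕ (suc n) ≡ 1ℚ + fromℕ n
  fromℕ-suc = fromℕ-+ 1

  m/n≡m*1/n : ∀ m n .{{_ : ℕ.NonZero n}} → + m / n ≡ fromℕ m * (+ 1 / n)
  m/n≡m*1/n m n@(suc k) = ℚ.toℚᵘ-injective (begin
    toℚᵘ (+ m / n)                           ≈⟨ toℚᵘ-/ (+ m) n ⟩
    mkℚᵘ (+ m) k                             ≈⟨ *≡* cross-multiplied ⟩
    mkℚᵘ (+ m) 0 ℚᵘ.* mkℚᵘ (+ 1) k           ≈⟨ ℚᵘ.*-cong (toℚᵘ-/ (+ m) 1) (toℚᵘ-/ (+ 1) n) ⟨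
    toℚᵘ (fromℕ m) ℚᵘ.* toℚᵘ (+ 1 / n)       ≈⟨ ℚ.toℚᵘ-homo-* (fromℕ m) (+ 1 / n) ⟨
    toℚᵘ (fromℕ m * (+ 1 / n))               ∎)
    where
    open ℚᵘ.≃-Reasoning
    cross-multiplied : + m ℤ.* + (1 ℕ.* n) ≡ (+ m ℤ.* + 1) ℤ.* + n
    cross-multiplied = cong₂ ℤ._*_ (sym (ℤ.*-identityʳ (+ m))) (cong +_ (ℕ.*-identityˡ n))

  n*1/n≡1 : ∀ n .{{_ : ℕ.NonZero n}} → fromℕ n * (+ 1 / n) ≡ 1ℚ
  n*1/n≡1 n@(suc k) = trans (sym (m/n≡m*1/n n n)) (ℚ.toℚᵘ-injective (begin
    toℚᵘ (+ n / n)     ≈⟨ toℚᵘ-/ (+ n) n ⟩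
    mkℚᵘ (+ n) k       ≈⟨ *≡* (trans (ℤ.*-identityʳ (+ n)) (sym (ℤ.*-identityˡ (+ n)))) ⟩
    toℚᵘ 1ℚ            ∎))
    where open ℚᵘ.≃-Reasoning

  k!*invFact≡1 : ∀ k → fromℕ (k !) * invFact k ≡ 1ℚ
  k!*invFact≡1 k = n*1/n≡1 (k !) {{k ℕ.!≢0}}

  suc*invFact-suc≡invFact : ∀ k → fromℕ (suc k) * invFact (suc k) ≡ invFact k
  suc*invFact-suc≡invFact k = begin
    a * invFact (suc k)                                   ≡⟨ ℚ.*-identityʳ _ ⟨
    a * invFact (suc k) * 1ℚ                              ≡⟨ cong (a * invFact (suc k) *_) (k!*invFact≡1 k) ⟨
    a * invFact (suc k) * (fromℕ (k !) * invFact k)       ≡⟨ regroup a (invFact (suc k)) (fromℕ (k !)) (invFact k) ⟩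
    a * fromℕ (k !) * invFact (suc k) * invFact k
      ≡⟨ cong (λ z → z * invFact (suc k) * invFact k) (fromℕ-* (suc k) (k !)) ⟨
    fromℕ (suc k !) * invFact (suc k) * invFact k         ≡⟨ cong (_* invFact k) (k!*invFact≡1 (suc k)) ⟩
    1ℚ * invFact k                                        ≡⟨ ℚ.*-identityˡ _ ⟩
    invFact k                                             ∎
    where
    open ≡-Reasoning
    a = fromℕ (suc k)
    regroup : ∀ a b c d → a * b * (c * d) ≡ a * c * b * d
    regroup = solve 4 (λ a b c d → a :* b :* (c :* d) := a :* c :* b :* d) refl

  altExpTerm : ℕ → ℚ
  altExpTerm k = negOnePow k * invFact k

  suc*altExpTerm-suc≡-altExpTerm : ∀ k → fromℕ (suc k) * altExpTerm (suc k) ≡ - altExpTerm k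
  suc*altExpTerm-suc≡-altExpTerm k =
    trans (pull (fromℕ (suc k)) (negOnePow k) (invFact (suc k)))
          (cong (λ z → - (negOnePow k * z)) (suc*invFact-suc≡invFact k))
    where
    pull : ∀ a s f → a * (- s * f) ≡ - (s * (a * f))
    pull = solve 3 (λ a s f → a :* (:- s :* f) := :- (s :* (a :* f))) refl

  sumℚ-∷ʳ : ∀ xs y → sumℚ (xs List.∷ʳ y) ≡ sumℚ xs + y
  sumℚ-∷ʳ []       y = trans (ℚ.+-identityʳ y) (sym (ℚ.+-identityˡ y))
  sumℚ-∷ʳ (x ∷ xs) y = trans (cong (_+_ x) (sumℚ-∷ʳ xs y)) (sym (ℚ.+-assoc x (sumℚ xs) y))

  sumℚ-applyUpTo-suc : ∀ f n → sumℚ (applyUpTo f (suc n)) ≡ sumℚ (applyUpTo f n) + f n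
  sumℚ-applyUpTo-suc f n = trans (cong sumℚ (sym (List.applyUpTo-∷ʳ f n))) (sumℚ-∷ʳ (applyUpTo f n) (f n))

  sumℚ-applyUpTo-altExpSum : ∀ m → sumℚ (applyUpTo altExpSum m) ≡ fromℕ (suc m) * altExpSum (suc m)
  sumℚ-applyUpTo-altExpSum zero    = refl
  sumℚ-applyUpTo-altExpSum (suc m) = begin
    sumℚ (applyUpTo altExpSum (suc m))       ≡⟨ sumℚ-applyUpTo-suc altExpSum m ⟩
    sumℚ (applyUpTo altExpSum m) + x         ≡⟨ cong (_+ x) (sumℚ-applyUpTo-altExpSum m) ⟩
    a * (x + u) + x                          ≡⟨ telescope a x u ⟩
    (1ℚ + a) * (x + u) + - u                 ≡⟨ cong (_+_ ((1ℚ + a) * (x + u))) next-term ⟨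
    (1ℚ + a) * (x + u) + (1ℚ + a) * v        ≡⟨ ℚ.*-distribˡ-+ (1ℚ + a) (x + u) v ⟨
    (1ℚ + a) * (x + u + v)                   ≡⟨ cong (_* altExpSum (2 ℕ.+ m)) (fromℕ-suc (suc m)) ⟨
    fromℕ (2 ℕ.+ m) * altExpSum (2 ℕ.+ m)    ∎
    where
    open ≡-Reasoning
    a = fromℕ (suc m)
    x = altExpSum m
    u = altExpTerm (suc m)
    v = altExpTerm (2 ℕ.+ m)
    next-term : (1ℚ + a) * v ≡ - u
    next-term = trans (cong (_* v) (sym (fromℕ-suc (suc m)))) (suc*altExpTerm-suc≡-altExpTerm (suc m))
    telescope : ∀ a x u → a * (x + u) + x ≡ (1ℚ + a) * (x + u) + - u
    telescope = solve 3 (λ a x u → a :* (x :+ u) :+ x := (con 1ℚ :+ a) :* (x :+ u) :+ :- u) refl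

  tabulate∘toℕ≡applyUpTo : ∀ {A : Set} n (f : ℕ → A) → List.tabulate {n = n} (f ∘ toℕ) ≡ applyUpTo f n
  tabulate∘toℕ≡applyUpTo zero    f = refl
  tabulate∘toℕ≡applyUpTo (suc n) f = cong (f 0 ∷_) (tabulate∘toℕ≡applyUpTo n (f ∘ suc))

  tabulate-inject₁-∷ʳ : ∀ {A : Set} n (f : Fin (suc n) → A) →
                        Vec.tabulate (f ∘ inject₁) ∷ʳ f (Fin.fromℕ n) ≡ Vec.tabulate f
  tabulate-inject₁-∷ʳ zero    f = refl
  tabulate-inject₁-∷ʳ (suc n) f = cong (f zero ∷_) (tabulate-inject₁-∷ʳ n (f ∘ suc))

  rStep-tabulate : ∀ m (f : ℕ → ℚ) → sumℚ (applyUpTo f m) ≡ fromℕ (suc m) * f (suc m) →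
                   rStep (Vec.tabulate {n = suc m} (f ∘ toℕ)) ≡ f (suc m)
  rStep-tabulate m f average = begin
    p * sumℚ (List.map (dVal v) (allFin (suc m)))
      ≡⟨ cong (λ s → p * sumℚ s) (List.map-tabulate (λ i → i) (dVal v)) ⟩
    p * (0ℚ + sumℚ (List.tabulate {n = m} (dVal v ∘ suc))) ≡⟨ cong (p *_) (ℚ.+-identityˡ _) ⟩
    p * sumℚ (List.tabulate {n = m} (dVal v ∘ suc))        ≡⟨ cong (λ s → p * sumℚ s) (List.tabulate-cong lookup-v) ⟩
    p * sumℚ (List.tabulate {n = m} (f ∘ toℕ))             ≡⟨ cong (λ s → p * sumℚ s) (tabulate∘toℕ≡applyUpTo m f) ⟩
    p * sumℚ (applyUpTo f m)                               ≡⟨ cong (p *_) average ⟩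
    p * (fromℕ (suc m) * f (suc m))                        ≡⟨ ℚ.*-assoc p (fromℕ (suc m)) (f (suc m)) ⟨
    p * fromℕ (suc m) * f (suc m)
      ≡⟨ cong (_* f (suc m)) (trans (ℚ.*-comm p (fromℕ (suc m))) (n*1/n≡1 (suc m))) ⟩
    1ℚ * f (suc m)                                         ≡⟨ ℚ.*-identityˡ (f (suc m)) ⟩
    f (suc m)                                              ∎
    where
    open ≡-Reasoning
    p = + 1 / suc m
    v = Vec.tabulate (f ∘ toℕ)
    lookup-v : ∀ i → lookup v (inject₁ i) ≡ f (toℕ i)
    lookup-v i = trans (Vec.lookup∘tabulate (f ∘ toℕ) (inject₁ i)) (cong f (Fin.toℕ-inject₁ i))

  rVals≡tabulate-altExpSum : ∀ m → rVals m ≡ Vec.tabulate (altExpSum ∘ toℕ)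
  rVals≡tabulate-altExpSum zero    = refl
  rVals≡tabulate-altExpSum (suc m) = begin
    rVals m ∷ʳ rStep (rVals m)                       ≡⟨ cong (λ v → v ∷ʳ rStep v) (rVals≡tabulate-altExpSum m) ⟩
    v ∷ʳ rStep v
      ≡⟨ cong₂ _∷ʳ_ (Vec.tabulate-cong (λ i → cong altExpSum (sym (Fin.toℕ-inject₁ i)))) last-value ⟩
    Vec.tabulate (altExpSum ∘ toℕ ∘ inject₁) ∷ʳ altExpSum (toℕ (Fin.fromℕ (suc m)))
                                                     ≡⟨ tabulate-inject₁-∷ʳ (suc m) (altExpSum ∘ toℕ) ⟩
    Vec.tabulate (altExpSum ∘ toℕ)                   ∎
    where
    open ≡-Reasoning
    v = Vec.tabulate (altExpSum ∘ toℕ)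
    last-value : rStep v ≡ altExpSum (toℕ (Fin.fromℕ (suc m)))
    last-value = trans (rStep-tabulate m altExpSum (sumℚ-applyUpTo-altExpSum m))
                       (cong altExpSum (sym (Fin.toℕ-fromℕ (suc m))))

  D≡altExpSum : ∀ n → D n ≡ altExpSum n
  D≡altExpSum zero    = refl
  D≡altExpSum (suc n) = begin
    Vec.last (rVals n ∷ʳ rStep (rVals n))               ≡⟨ Vec.last-∷ʳ (rStep (rVals n)) (rVals n) ⟩
    rStep (rVals n)                                      ≡⟨ cong rStep (rVals≡tabulate-altExpSum n) ⟩
    rStep (Vec.tabulate {n = suc n} (altExpSum ∘ toℕ))  ≡⟨ rStep-tabulate n altExpSum (sumℚ-applyUpTo-altExpSum n) ⟩
    altExpSum (suc n)                                    ∎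
    where open ≡-Reasoning

  scaledAltExpSum : ℕ → ℚ
  scaledAltExpSum k = fromℕ (k !) * altExpSum k

  scaledAltExpSum-suc : ∀ k → scaledAltExpSum (suc k) ≡ fromℕ (suc k) * scaledAltExpSum k + negOnePow (suc k)
  scaledAltExpSum-suc k = begin
    fromℕ (suc k !) * (x + s * f)                        ≡⟨ cong (_* (x + s * f)) (fromℕ-* (suc k) (k !)) ⟩
    a * b * (x + s * f)                                  ≡⟨ expand a b x s f ⟩
    a * (b * x) + s * (a * b * f)                        ≡⟨ cong (λ z → a * (b * x) + s * (z * f)) (fromℕ-* (suc k) (k !)) ⟨
    a * (b * x) + s * (fromℕ (suc k !) * f)              ≡⟨ cong (λ z → a * (b * x) + s * z) (k!*invFact≡1 (suc k)) ⟩
    a * (b * x) + s * 1ℚ                                 ≡⟨ cong (_+_ (a * (b * x))) (ℚ.*-identityʳ s) ⟩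
    a * (b * x) + s                                      ∎
    where
    open ≡-Reasoning
    a = fromℕ (suc k)
    b = fromℕ (k !)
    x = altExpSum k
    s = negOnePow (suc k)
    f = invFact (suc k)
    expand : ∀ a b x s f → a * b * (x + s * f) ≡ a * (b * x) + s * (a * b * f)
    expand = solve 5 (λ a b x s f → a :* b :* (x :+ s :* f) := a :* (b :* x) :+ s :* (a :* b :* f)) refl

  scaledAltExpSum-suc-suc : ∀ k → scaledAltExpSum (2 ℕ.+ k) ≡ fromℕ (suc k) * (scaledAltExpSum (suc k) + scaledAltExpSum k)
  scaledAltExpSum-suc-suc k = begin
    scaledAltExpSum (2 ℕ.+ k)                  ≡⟨ scaledAltExpSum-suc (suc k) ⟩
    fromℕ (2 ℕ.+ k) * y₁ + - s                 ≡⟨ cong₂ (λ c z → c * z + - s) (fromℕ-suc (suc k)) (scaledAltExpSum-suc k) ⟩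
    (1ℚ + a) * (a * y₀ + s) + - s              ≡⟨ rearrange a y₀ s ⟩
    a * ((a * y₀ + s) + y₀)                    ≡⟨ cong (λ z → a * (z + y₀)) (scaledAltExpSum-suc k) ⟨
    a * (y₁ + y₀)                              ∎
    where
    open ≡-Reasoning
    a = fromℕ (suc k)
    s = negOnePow (suc k)
    y₀ = scaledAltExpSum k
    y₁ = scaledAltExpSum (suc k)
    rearrange : ∀ a y s → (1ℚ + a) * (a * y + s) + - s ≡ a * ((a * y + s) + y)
    rearrange = solve 3 (λ a y s → (con 1ℚ :+ a) :* (a :* y :+ s) :+ :- s := a :* ((a :* y :+ s) :+ y)) refl

  fromℕ-derangements : ∀ n → fromℕ (derangements n) ≡ scaledAltExpSum n
  fromℕ-derangements zero          = refl
  fromℕ-derangements (suc zero)    = refl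
  fromℕ-derangements (suc (suc n)) = begin
    fromℕ (derangements (2 ℕ.+ n))                              ≡⟨ cong fromℕ (derangements-suc-suc n) ⟩
    fromℕ (suc n ℕ.* (d₁ ℕ.+ d₀))                               ≡⟨ fromℕ-* (suc n) (d₁ ℕ.+ d₀) ⟩
    fromℕ (suc n) * fromℕ (d₁ ℕ.+ d₀)                           ≡⟨ cong (fromℕ (suc n) *_) (fromℕ-+ d₁ d₀) ⟩
    fromℕ (suc n) * (fromℕ d₁ + fromℕ d₀)
      ≡⟨ cong₂ (λ y z → fromℕ (suc n) * (y + z)) (fromℕ-derangements (suc n)) (fromℕ-derangements n) ⟩
    fromℕ (suc n) * (scaledAltExpSum (suc n) + scaledAltExpSum n) ≡⟨ scaledAltExpSum-suc-suc n ⟨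
    scaledAltExpSum (2 ℕ.+ n)                                    ∎
    where
    open ≡-Reasoning
    d₀ = derangements n
    d₁ = derangements (suc n)

  derangements/n!≡altExpSum : ∀ n → ((+ derangements n) / (n !)) {{n ℕ.!≢0}} ≡ altExpSum n
  derangements/n!≡altExpSum n = begin
    (+ derangements n / n !) {{n ℕ.!≢0}}        ≡⟨ m/n≡m*1/n (derangements n) (n !) {{n ℕ.!≢0}} ⟩
    fromℕ (derangements n) * invFact n         ≡⟨ cong (_* invFact n) (fromℕ-derangements n) ⟩
    fromℕ (n !) * altExpSum n * invFact n      ≡⟨ swap (fromℕ (n !)) (altExpSum n) (invFact n) ⟩
    altExpSum n * (fromℕ (n !) * invFact n)    ≡⟨ cong (altExpSum n *_) (k!*invFact≡1 n) ⟩
    altExpSum n * 1ℚ                           ≡⟨ ℚ.*-identityʳ (altExpSum n) ⟩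
    altExpSum n                                ∎
    where
    open ≡-Reasoning
    swap : ∀ a x f → a * x * f ≡ x * (a * f)
    swap = solve 3 (λ a x f → a :* x :* f := x :* (a :* f)) refl

open AlternatingSeries using (D≡altExpSum; derangements/n!≡altExpSum)
open import Relation.Binary.PropositionalEquality using (trans; sym)

mainTheorem1 : (n : ℕ) → 1 ≤ n →
    (D n ≡ altExpSum n) × (D n ≡ ((+ derangements n) / (n !)) {{n !≢0}})
mainTheorem1 n _ = D≡altExpSum n , trans (D≡altExpSum n) (sym (derangements/n!≡altExpSum n))
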